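{- Let $n\ge 4$. If $G$ is a $K_{2,3}$-saturated bipartite graph with vertex classes $U$ and $U'$ each of size $n$, then $G$ has at least $3n-2$ edges.
   Context: $G$ is $K_{2,3}$-saturated if it contains no copy of $K_{2,3}$, and adding any missing edge $uu'$ with $u\in U$ and $u'\in U'$ creates a new copy of $K_{2,3}$ (one containing $uu'$). This copy may have $2$ vertices in $U$ and $3$ in $U'$, or $3$ vertices in $U$ and $2$ in $U'$. -}

module Defs where

open import Data.Nat using (ℕ)
open import Data.Bool using (Bool; true; false; if_then_else_; _∨_; _∧_)
open import Data.Fin using (Fin; _≟_)
open import Data.List using (map; allFin)
open import Data.Nat.ListAction using (sum)
open import Data.Product using (Σ; ∃; _×_)
open import Data.Sum using (_⊎_)
open import Relation.Nullary using (¬_)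
open import Relation.Nullary.Decidable using (⌊_⌋)
open import Relation.Binary.PropositionalEquality using (_≡_)
open import Function.Definitions using (Injective)

-- A bipartite graph with vertex classes U = Fin n and U' = Fin n
-- is given by its biadjacency relation: E u u' = true iff uu' is an edge.
BipGraph : ℕ → Set
BipGraph n = Fin n → Fin n → Bool

Adj : ∀ {n} → BipGraph n → Fin n → Fin n → Set
Adj E u u' = E u u' ≡ true

edgeCount : ∀ {n} → BipGraph n → ℕ
edgeCount {n} E =
  sum (map (λ u → sum (map (λ u' → if E u u' then 1 else 0) (allFin n))) (allFin n))

addEdge : ∀ {n} → BipGraph n → Fin n → Fin n → BipGraph n
addEdge E u u' x y = E x y ∨ (⌊ x ≟ u ⌋ ∧ ⌊ y ≟ u' ⌋)

CopyK : ∀ {n} → ℕ → ℕ → BipGraph n → Set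
CopyK {n} a b E =
  Σ (Fin a → Fin n) λ f → Σ (Fin b → Fin n) λ g →
    Injective _≡_ _≡_ f × Injective _≡_ _≡_ g × (∀ i j → Adj E (f i) (g j))

CopyKWith : ∀ {n} → ℕ → ℕ → BipGraph n → Fin n → Fin n → Set
CopyKWith {n} a b E u u' =
  Σ (Fin a → Fin n) λ f → Σ (Fin b → Fin n) λ g →
    Injective _≡_ _≡_ f × Injective _≡_ _≡_ g × (∀ i j → Adj E (f i) (g j))
    × (∃ λ i → f i ≡ u) × (∃ λ j → g j ≡ u')

ContainsK23 : ∀ {n} → BipGraph n → Set
ContainsK23 E = CopyK 2 3 E ⊎ CopyK 3 2 E

ContainsK23With : ∀ {n} → BipGraph n → Fin n → Fin n → Set
ContainsK23With E u u' = CopyKWith 2 3 E u u' ⊎ CopyKWith 3 2 E u u'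

K23Saturated : ∀ {n} → BipGraph n → Set
K23Saturated {n} E =
  ¬ ContainsK23 E ×
  (∀ (u u' : Fin n) → E u u' ≡ false → ContainsK23With (addEdge E u u') u u')

module Submission where

-- Rows are U and columns U′.  Saturation is used through two facts that are
-- symmetric under transposing the graph (SatFacts): no two vertices of one
-- class share three neighbours, and every non-edge uy is completed to a
-- K_{2,3} either by a row w sharing two columns with u and adjacent to y, or
-- by a column w adjacent to u and sharing two rows with y.
--
-- Every bound comes from one double count (split-bound): for a set C of rows,
--   e = Σ_y |N(y) ∩ C| + Σ_{s ∉ C} deg s,
-- and 3n − 2 ≤ e as soon as the column sums reach 2n + |C| − 2 − k while the
-- rows outside C carry k + |U ∖ C| edges.  The cases are: a vertex of degree
-- one with neighbour v (C = N(v)); a row of degree two with neighbours a, b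
-- (C = N(a) ∪ N(b)), split by whether a second row sees both a and b; and all
-- row degrees at least three.

open import Defs
open import Data.Nat using (ℕ; zero; suc; _+_; _*_; _∸_; _≤_; _<_; _<?_; _≤?_; z≤n; s≤s; s≤s⁻¹)
  renaming (_≟_ to _≟ℕ_)
open import Data.Nat.Properties hiding (_≟_)
open import Data.Nat.Tactic.RingSolver using (solve-∀)
import Data.Nat.ListAction as List
open import Data.Bool using (Bool; true; false; if_then_else_; _∨_; _∧_; not)
  renaming (_≟_ to _≟ᵇ_)
open import Data.Bool.Properties using (∧-idem; ∧-identityʳ; ∧-zeroʳ; ∧-abs-∨; ∨-comm; ∨-zeroʳ; ¬-not)
open import Data.Fin using (Fin; zero; suc; _≟_; punchIn)
open import Data.Fin.Properties using (punchInᵢ≢i; any?; all?; ¬∀⟶∃¬)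
open import Data.List using (map; allFin; tabulate)
open import Data.List.Properties using (map-tabulate)
open import Data.Product using (Σ; ∃; _×_; _,_; proj₁; proj₂)
open import Data.Sum using (_⊎_; inj₁; inj₂; swap)
open import Function.Definitions using (Injective)
open import Function using (_∘_)
open import Data.Empty using (⊥; ⊥-elim)
open import Relation.Nullary using (¬_; Dec; yes; no; does; ¬?; _×-dec_)
open import Relation.Nullary.Decidable using (dec-true; dec-false)
open import Relation.Binary.PropositionalEquality hiding ([_])
open import Algebra.Properties.Semiring.Sum +-*-semiring
  using (sum; ∑-distrib-+; ∑-comm; sum-cong-≗; sum-remove; *-distribˡ-sum)

does-sound : ∀ {P : Set} (d : Dec P) → does d ≡ true → P
does-sound (yes p) _ = p

does-refute : ∀ {P : Set} (d : Dec P) → does d ≡ false → ¬ P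
does-refute (no ¬p) _ = ¬p

true≢false : ∀ {b : Bool} → b ≡ true → b ≡ false → ⊥
true≢false refl ()

∧-intro : ∀ {a b : Bool} → a ≡ true → b ≡ true → a ∧ b ≡ true
∧-intro refl refl = refl

∧-elimˡ : ∀ {a b : Bool} → a ∧ b ≡ true → a ≡ true
∧-elimˡ {true} _ = refl

∧-elimʳ : ∀ {a b : Bool} → a ∧ b ≡ true → b ≡ true
∧-elimʳ {true} h = h

∧-falseʳ : ∀ {a b : Bool} → b ≡ false → a ∧ b ≡ false
∧-falseʳ {a} refl = ∧-zeroʳ a

∨-introˡ : ∀ {a b : Bool} → a ≡ true → a ∨ b ≡ true
∨-introˡ refl = refl

∨-introʳ : ∀ {a b : Bool} → b ≡ true → a ∨ b ≡ true
∨-introʳ {a} refl = ∨-zeroʳ a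

not-false : ∀ {b : Bool} → not b ≡ false → b ≡ true
not-false {true} _ = refl

not-true : ∀ {b : Bool} → not b ≡ true → b ≡ false
not-true {false} _ = refl

swap-outer : ∀ x y z → x + y + z ≡ z + y + x
swap-outer = solve-∀

swap-last : ∀ x y z → x + y + z ≡ x + z + y
swap-last = solve-∀

∑-mono : ∀ {n} {f g : Fin n → ℕ} → (∀ i → f i ≤ g i) → sum f ≤ sum g
∑-mono {zero} _ = z≤n
∑-mono {suc n} h = +-mono-≤ (h zero) (∑-mono (λ i → h (suc i)))

∑-const : ∀ n c → sum {n} (λ _ → c) ≡ n * c
∑-const zero c = refl
∑-const (suc n) c = cong (c +_) (∑-const n c)

∑-term : ∀ {n} (f : Fin n → ℕ) a → f a ≤ sum f
∑-term f zero = m≤m+n _ _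
∑-term f (suc a) = ≤-trans (∑-term (λ i → f (suc i)) a) (m≤n+m _ _)

∑-except-one : ∀ {n} (f g : Fin n → ℕ) a → (∀ y → y ≢ a → g y ≤ f y) →
               sum g + f a ≤ sum f + g a
∑-except-one {suc n} f g a h = begin
  sum g + f a                                ≡⟨ cong (_+ f a) (sum-remove {i = a} g) ⟩
  g a + sum (λ j → g (punchIn a j)) + f a    ≤⟨ +-monoˡ-≤ (f a) (+-monoʳ-≤ (g a) (∑-mono off-a)) ⟩
  g a + sum (λ j → f (punchIn a j)) + f a    ≡⟨ swap-outer (g a) _ (f a) ⟩
  f a + sum (λ j → f (punchIn a j)) + g a    ≡⟨ cong (_+ g a) (sym (sum-remove {i = a} f)) ⟩
  sum f + g a                                ∎
  where
    open ≤-Reasoning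
    off-a : ∀ j → g (punchIn a j) ≤ f (punchIn a j)
    off-a j = h (punchIn a j) (punchInᵢ≢i a j)

-- Apply the one-point version twice, passing
-- through the function that agrees with f at b and with g elsewhere.
∑-except-two : ∀ {n} (f g : Fin n → ℕ) a b → a ≢ b →
               (∀ y → y ≢ a → y ≢ b → g y ≤ f y) →
               sum g + f a + f b ≤ sum f + g a + g b
∑-except-two f g a b a≢b h = begin
  sum g + f a + f b     ≡⟨ swap-last (sum g) (f a) (f b) ⟩
  sum g + f b + f a     ≤⟨ +-monoˡ-≤ (f a) (≤-trans (≤-reflexive (cong (sum g +_) (sym mid-b)))
                                                     (∑-except-one mid g b g≤mid)) ⟩
  sum mid + g b + f a   ≡⟨ swap-last (sum mid) (g b) (f a) ⟩
  sum mid + f a + g b   ≤⟨ +-monoˡ-≤ (g b) (≤-trans (∑-except-one f mid a mid≤f)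
                                                     (≤-reflexive (cong (sum f +_) mid-a))) ⟩
  sum f + g a + g b     ∎
  where
    open ≤-Reasoning
    mid : Fin _ → ℕ
    mid y with y ≟ b
    ... | yes _ = f y
    ... | no _ = g y
    mid-b : mid b ≡ f b
    mid-b with b ≟ b
    ... | yes _ = refl
    ... | no b≢b = ⊥-elim (b≢b refl)
    mid-a : mid a ≡ g a
    mid-a with a ≟ b
    ... | yes a≡b = ⊥-elim (a≢b a≡b)
    ... | no _ = refl
    g≤mid : ∀ y → y ≢ b → g y ≤ mid y
    g≤mid y y≢b with y ≟ b
    ... | yes y≡b = ⊥-elim (y≢b y≡b)
    ... | no _ = ≤-refl
    mid≤f : ∀ y → y ≢ a → mid y ≤ f y
    mid≤f y y≢a with y ≟ b
    ... | yes _ = ≤-refl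
    ... | no y≢b = h y y≢a y≢b

[_] : Bool → ℕ
[ b ] = if b then 1 else 0

# : ∀ {n} → (Fin n → Bool) → ℕ
# P = sum (λ i → [ P i ])

_≐_ : ∀ {n} → Fin n → Fin n → Bool
i ≐ j = does (i ≟ j)

≐-refl : ∀ {n} (i : Fin n) → i ≐ i ≡ true
≐-refl i = dec-true (i ≟ i) refl

≐-≢ : ∀ {n} {i j : Fin n} → i ≢ j → i ≐ j ≡ false
≐-≢ {i = i} {j} = dec-false (i ≟ j)

not≐⇒≢ : ∀ {n} {i j : Fin n} → not (i ≐ j) ≡ true → i ≢ j
not≐⇒≢ {i = i} {j} h i≡j with i ≟ j | h
... | no i≢j | _ = i≢j i≡j

#-point : ∀ {n} (a : Fin n) → # (λ i → i ≐ a) ≡ 1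
#-point {suc n} a = begin
  # (λ i → i ≐ a)                               ≡⟨ sum-remove {i = a} (λ i → [ i ≐ a ]) ⟩
  [ a ≐ a ] + sum (λ j → [ punchIn a j ≐ a ])   ≡⟨ cong₂ _+_ (cong [_] (≐-refl a)) (sum-cong-≗ off-a) ⟩
  1 + sum {n} (λ _ → 0)                         ≡⟨ cong suc (trans (∑-const n 0) (*-zeroʳ n)) ⟩
  1                                             ∎
  where
    open ≡-Reasoning
    off-a : ∀ j → [ punchIn a j ≐ a ] ≡ 0
    off-a j = cong [_] (≐-≢ (punchInᵢ≢i a j))

#-split : ∀ {n} (P Q : Fin n → Bool) → # P ≡ # (λ i → P i ∧ Q i) + # (λ i → P i ∧ not (Q i))
#-split P Q = trans (sum-cong-≗ pw) (∑-distrib-+ (λ i → [ P i ∧ Q i ]) (λ i → [ P i ∧ not (Q i) ]))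
  where
    pw : ∀ i → [ P i ] ≡ [ P i ∧ Q i ] + [ P i ∧ not (Q i) ]
    pw i with P i | Q i
    ... | true  | true  = refl
    ... | true  | false = refl
    ... | false | _     = refl

#-complement : ∀ {n} (Q : Fin n → Bool) → # Q + # (λ i → not (Q i)) ≡ n
#-complement {n} Q = begin
  # Q + # (λ i → not (Q i))           ≡⟨ ∑-distrib-+ (λ i → [ Q i ]) (λ i → [ not (Q i) ]) ⟨
  sum (λ i → [ Q i ] + [ not (Q i) ]) ≡⟨ sum-cong-≗ pw ⟩
  sum {n} (λ _ → 1)                   ≡⟨ trans (∑-const n 1) (*-identityʳ n) ⟩
  n                                   ∎
  where
    open ≡-Reasoning
    pw : ∀ i → [ Q i ] + [ not (Q i) ] ≡ 1
    pw i with Q i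
    ... | true  = refl
    ... | false = refl

#-union : ∀ {n} (A B : Fin n → Bool) → # A + # B ≡ # (λ i → A i ∨ B i) + # (λ i → A i ∧ B i)
#-union A B = begin
  # A + # B                                 ≡⟨ ∑-distrib-+ (λ i → [ A i ]) (λ i → [ B i ]) ⟨
  sum (λ i → [ A i ] + [ B i ])             ≡⟨ sum-cong-≗ pw ⟩
  sum (λ i → [ A i ∨ B i ] + [ A i ∧ B i ]) ≡⟨ ∑-distrib-+ (λ i → [ A i ∨ B i ]) (λ i → [ A i ∧ B i ]) ⟩
  # (λ i → A i ∨ B i) + # (λ i → A i ∧ B i) ∎
  where
    open ≡-Reasoning
    pw : ∀ i → [ A i ] + [ B i ] ≡ [ A i ∨ B i ] + [ A i ∧ B i ]
    pw i with A i | B i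
    ... | true  | true  = refl
    ... | true  | false = refl
    ... | false | true  = refl
    ... | false | false = refl

[]-mono : ∀ {a b : Bool} → (a ≡ true → b ≡ true) → [ a ] ≤ [ b ]
[]-mono {false} _ = z≤n
[]-mono {true} h rewrite h refl = ≤-refl

#-mono : ∀ {n} {P Q : Fin n → Bool} → (∀ i → P i ≡ true → Q i ≡ true) → # P ≤ # Q
#-mono h = ∑-mono (λ i → []-mono (h i))

#-≥1 : ∀ {n} (P : Fin n → Bool) i → P i ≡ true → 1 ≤ # P
#-≥1 P i Pi = ≤-trans (≤-reflexive (cong [_] (sym Pi))) (∑-term (λ j → [ P j ]) i)

#-witness : ∀ {n} (P : Fin n → Bool) → 1 ≤ # P → ∃ λ i → P i ≡ true
#-witness {suc n} P h with P zero in P0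
... | true  = zero , P0
... | false = let (i , Pi) = #-witness (λ i → P (suc i)) h in suc i , Pi

#-empty : ∀ {n} (P : Fin n → Bool) → # P ≡ 0 → ∀ i → P i ≡ false
#-empty P #P≡0 i with P i in Pi
... | false = refl
... | true  with () ← ≤-trans (#-≥1 P i Pi) (≤-reflexive #P≡0)

#-none : ∀ {n} (P : Fin n → Bool) → (∀ i → P i ≡ false) → # P ≡ 0
#-none {n} P none = trans (sum-cong-≗ (λ i → cong [_] (none i))) (trans (∑-const n 0) (*-zeroʳ n))

[]-≤ : ∀ {b : Bool} {N : ℕ} → (b ≡ true → 1 ≤ N) → [ b ] ≤ N
[]-≤ {false} _ = z≤n
[]-≤ {true} h = h refl

#-remove : ∀ {n} (P : Fin n → Bool) a → P a ≡ true → # P ≡ suc (# (λ i → P i ∧ not (i ≐ a)))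
#-remove P a Pa = begin
  # P                                               ≡⟨ sum-cong-≗ pw ⟩
  sum (λ i → [ P i ∧ not (i ≐ a) ] + [ i ≐ a ])     ≡⟨ ∑-distrib-+ (λ i → [ P i ∧ not (i ≐ a) ]) (λ i → [ i ≐ a ]) ⟩
  # (λ i → P i ∧ not (i ≐ a)) + # (λ i → i ≐ a)     ≡⟨ cong (# (λ i → P i ∧ not (i ≐ a)) +_) (#-point a) ⟩
  # (λ i → P i ∧ not (i ≐ a)) + 1                   ≡⟨ +-comm _ 1 ⟩
  suc (# (λ i → P i ∧ not (i ≐ a)))                 ∎
  where
    open ≡-Reasoning
    pw : ∀ i → [ P i ] ≡ [ P i ∧ not (i ≐ a) ] + [ i ≐ a ]
    pw i with i ≟ a
    ... | yes refl rewrite Pa = refl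
    ... | no _ with P i
    ...   | true  = refl
    ...   | false = refl

#-≥2 : ∀ {n} (P : Fin n → Bool) i j → P i ≡ true → P j ≡ true → i ≢ j → 2 ≤ # P
#-≥2 P i j Pi Pj i≢j rewrite #-remove P i Pi =
  s≤s (#-≥1 _ j (∧-intro Pj (cong not (≐-≢ (λ j≡i → i≢j (sym j≡i))))))

#-strict : ∀ {n} (P Q : Fin n → Bool) z → (∀ i → P i ≡ true → Q i ≡ true) →
           Q z ≡ true → P z ≡ false → suc (# P) ≤ # Q
#-strict P Q z P⊆Q Qz Pz = begin
  suc (# P)                        ≡⟨ +-comm 1 (# P) ⟩
  # P + 1                          ≡⟨ cong (# P +_) (#-point z) ⟨
  # P + # (λ i → i ≐ z)            ≡⟨ ∑-distrib-+ (λ i → [ P i ]) (λ i → [ i ≐ z ]) ⟨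
  sum (λ i → [ P i ] + [ i ≐ z ])  ≤⟨ ∑-mono pw ⟩
  # Q                              ∎
  where
    open ≤-Reasoning
    pw : ∀ i → [ P i ] + [ i ≐ z ] ≤ [ Q i ]
    pw i with i ≟ z
    ... | yes refl rewrite Pz | Qz = ≤-refl
    ... | no _ = ≤-trans (≤-reflexive (+-identityʳ _)) ([]-mono (P⊆Q i))

#-three : ∀ {n} (P Q : Fin n → Bool) z → (∀ i → P i ≡ true → Q i ≡ true) →
          2 ≤ # P → Q z ≡ true → P z ≡ false → 3 ≤ # Q
#-three P Q z P⊆Q #P≥2 Qz Pz = ≤-trans (s≤s #P≥2) (#-strict P Q z P⊆Q Qz Pz)

#-unique : ∀ {n} (P : Fin n → Bool) → 1 ≤ # P → # P ≤ 1 →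
           ∃ λ v → P v ≡ true × (∀ s → P s ≡ true → s ≡ v)
#-unique P ≥1 ≤1 with #-witness P ≥1
... | v , Pv = v , Pv , only-v
  where
    rest-empty : # (λ i → P i ∧ not (i ≐ v)) ≡ 0
    rest-empty = n≤0⇒n≡0 (s≤s⁻¹ (≤-trans (≤-reflexive (sym (#-remove P v Pv))) ≤1))
    only-v : ∀ s → P s ≡ true → s ≡ v
    only-v s Ps with s ≟ v
    ... | yes s≡v = s≡v
    ... | no s≢v = ⊥-elim (true≢false (∧-intro Ps (cong not (≐-≢ s≢v))) (#-empty _ rest-empty s))

#-pair : ∀ {n} (P : Fin n → Bool) → 2 ≤ # P → # P ≤ 2 →
         Σ (Fin n) λ a → Σ (Fin n) λ b → a ≢ b × P a ≡ true × P b ≡ true ×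
         (∀ s → P s ≡ true → s ≡ a ⊎ s ≡ b)
#-pair P ≥2 ≤2 with #-witness P (≤-trans (s≤s z≤n) ≥2)
... | a , Pa with #-unique (λ i → P i ∧ not (i ≐ a))
                   (s≤s⁻¹ (≤-trans ≥2 (≤-reflexive (#-remove P a Pa))))
                   (s≤s⁻¹ (≤-trans (≤-reflexive (sym (#-remove P a Pa))) ≤2))
... | b , Pb , only-b = a , b , a≢b , Pa , ∧-elimˡ Pb , only-ab
  where
    a≢b : a ≢ b
    a≢b refl = true≢false (∧-elimʳ {P a} Pb) (cong not (≐-refl a))
    only-ab : ∀ s → P s ≡ true → s ≡ a ⊎ s ≡ b
    only-ab s Ps with s ≟ a
    ... | yes s≡a = inj₁ s≡a
    ... | no s≢a = inj₂ (only-b s (∧-intro Ps (cong not (≐-≢ s≢a))))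

deg : ∀ {n} → BipGraph n → Fin n → ℕ
deg E u = # (E u)

edges : ∀ {n} → BipGraph n → ℕ
edges E = sum (deg E)

edgeCount≡edges : ∀ {n} (E : BipGraph n) → edgeCount E ≡ edges E
edgeCount≡edges {n} E =
  trans (listSum-allFin (λ u → List.sum (map (λ y → [ E u y ]) (allFin n))))
        (sum-cong-≗ (λ u → listSum-allFin (λ y → [ E u y ])))
  where
    listSum-tabulate : ∀ {m} (f : Fin m → ℕ) → List.sum (tabulate f) ≡ sum f
    listSum-tabulate {zero} f = refl
    listSum-tabulate {suc m} f = cong (f zero +_) (listSum-tabulate (λ i → f (suc i)))
    listSum-allFin : (f : Fin n → ℕ) → List.sum (map f (allFin n)) ≡ sum f
    listSum-allFin f = trans (cong List.sum (map-tabulate (λ i → i) f)) (listSum-tabulate f)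

_ᵀ : ∀ {n} → BipGraph n → BipGraph n
(E ᵀ) x y = E y x

edges-ᵀ : ∀ {n} (E : BipGraph n) → edges (E ᵀ) ≡ edges E
edges-ᵀ E = ∑-comm (λ u y → [ E y u ])

module _ {n : ℕ} (E : BipGraph n) (C : Fin n → Bool) where

  inside : Fin n → ℕ
  inside y = # (λ s → E s y ∧ C s)

  outside : ℕ
  outside = sum (λ s → # (λ y → E s y ∧ not (C s)))

  edges-split : edges E ≡ sum inside + outside
  edges-split = begin
    sum (λ s → # (E s))                                          ≡⟨ ∑-comm (λ s y → [ E s y ]) ⟩
    sum (λ y → # (λ s → E s y))                                  ≡⟨ sum-cong-≗ (λ y → #-split (λ s → E s y) C) ⟩
    sum (λ y → inside y + # (λ s → E s y ∧ not (C s)))            ≡⟨ ∑-distrib-+ inside _ ⟩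
    sum inside + sum (λ y → # (λ s → E s y ∧ not (C s)))          ≡⟨ cong (sum inside +_) (∑-comm (λ y s → [ E s y ∧ not (C s) ])) ⟩
    sum inside + outside                                         ∎
    where open ≡-Reasoning

  outside-≥ : ∀ c → (∀ s → C s ≡ false → c ≤ deg E s) → c * # (λ s → not (C s)) ≤ outside
  outside-≥ c h = begin
    c * # (λ s → not (C s))          ≡⟨ *-distribˡ-sum c (λ s → [ not (C s) ]) ⟩
    sum (λ s → c * [ not (C s) ])    ≤⟨ ∑-mono per-row ⟩
    outside                          ∎
    where
      open ≤-Reasoning
      per-row : ∀ s → c * [ not (C s) ] ≤ # (λ y → E s y ∧ not (C s))
      per-row s with C s in Cs
      ... | true  = ≤-trans (≤-reflexive (*-zeroʳ c)) z≤n
      ... | false = ≤-trans (≤-reflexive (*-identityʳ c))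
                      (≤-trans (h s Cs) (≤-reflexive (sum-cong-≗ (λ y → cong [_] (sym (∧-identityʳ (E s y)))))))

  split-bound : ∀ k → 2 * n + # C ≤ sum inside + k + 2 →
                k + # (λ s → not (C s)) ≤ outside → 3 * n ≤ edges E + 2
  split-bound k ins out = +-cancelʳ-≤ k (3 * n) (edges E + 2) (begin
    3 * n + k                           ≡⟨ cong (λ m → 3 * m + k) (#-complement C) ⟨
    3 * (c + z) + k                     ≡⟨ regroup c z k ⟩
    2 * (c + z) + c + (k + z)           ≡⟨ cong (λ m → 2 * m + c + (k + z)) (#-complement C) ⟩
    2 * n + c + (k + z)                 ≤⟨ +-mono-≤ ins out ⟩
    sum inside + k + 2 + outside        ≡⟨ regroup′ (sum inside) k outside ⟩
    sum inside + outside + 2 + k        ≡⟨ cong (λ m → m + 2 + k) edges-split ⟨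
    edges E + 2 + k                     ∎)
    where
      open ≤-Reasoning
      c = # C
      z = # (λ s → not (C s))
      regroup : ∀ c z k → 3 * (c + z) + k ≡ 2 * (c + z) + c + (k + z)
      regroup = solve-∀
      regroup′ : ∀ i k o → i + k + 2 + o ≡ i + o + 2 + k
      regroup′ = solve-∀

-- A K_{2,3} with three rows
-- is a K_{2,3} in the transposed graph, so both shapes are covered by
-- applying these notions to E and to E ᵀ.

module _ {n : ℕ} (E : BipGraph n) where

  NoK₂₃ : Set
  NoK₂₃ = ∀ {u w y₁ y₂ y₃} → u ≢ w → y₁ ≢ y₂ → y₁ ≢ y₃ → y₂ ≢ y₃ →
          E u y₁ ≡ true → E u y₂ ≡ true → E u y₃ ≡ true →
          E w y₁ ≡ true → E w y₂ ≡ true → E w y₃ ≡ true → ⊥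

  record Completion (u y : Fin n) : Set where
    constructor completion
    field
      w       : Fin n
      w≢u     : w ≢ u
      w~y     : E w y ≡ true
      t₁ t₂   : Fin n
      t₁≢t₂   : t₁ ≢ t₂
      u~t₁    : E u t₁ ≡ true
      w~t₁    : E w t₁ ≡ true
      u~t₂    : E u t₂ ≡ true
      w~t₂    : E w t₂ ≡ true

record SatFacts {n : ℕ} (E : BipGraph n) : Set where
  field
    no-K₂₃   : NoK₂₃ E
    no-K₃₂   : NoK₂₃ (E ᵀ)
    complete : ∀ u y → E u y ≡ false → Completion E u y ⊎ Completion (E ᵀ) y u

SatFacts-ᵀ : ∀ {n} {E : BipGraph n} → SatFacts E → SatFacts (E ᵀ)
SatFacts-ᵀ S = record
  { no-K₂₃   = SatFacts.no-K₃₂ S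
  ; no-K₃₂   = SatFacts.no-K₂₃ S
  ; complete = λ u y uy → swap (SatFacts.complete S y u uy) }

pair : ∀ {n} → Fin n → Fin n → Fin 2 → Fin n
pair a b zero = a
pair a b (suc zero) = b

triple : ∀ {n} → Fin n → Fin n → Fin n → Fin 3 → Fin n
triple a b c zero = a
triple a b c (suc zero) = b
triple a b c (suc (suc zero)) = c

pair-injective : ∀ {n} {a b : Fin n} → a ≢ b → Injective _≡_ _≡_ (pair a b)
pair-injective a≢b {zero}     {zero}     _ = refl
pair-injective a≢b {zero}     {suc zero} e = ⊥-elim (a≢b e)
pair-injective a≢b {suc zero} {zero}     e = ⊥-elim (a≢b (sym e))
pair-injective a≢b {suc zero} {suc zero} _ = refl

triple-injective : ∀ {n} {a b c : Fin n} → a ≢ b → a ≢ c → b ≢ c → Injective _≡_ _≡_ (triple a b c)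
triple-injective a≢b a≢c b≢c {zero}           {zero}           _ = refl
triple-injective a≢b a≢c b≢c {zero}           {suc zero}       e = ⊥-elim (a≢b e)
triple-injective a≢b a≢c b≢c {zero}           {suc (suc zero)} e = ⊥-elim (a≢c e)
triple-injective a≢b a≢c b≢c {suc zero}       {zero}           e = ⊥-elim (a≢b (sym e))
triple-injective a≢b a≢c b≢c {suc zero}       {suc zero}       _ = refl
triple-injective a≢b a≢c b≢c {suc zero}       {suc (suc zero)} e = ⊥-elim (b≢c e)
triple-injective a≢b a≢c b≢c {suc (suc zero)} {zero}           e = ⊥-elim (a≢c (sym e))
triple-injective a≢b a≢c b≢c {suc (suc zero)} {suc zero}       e = ⊥-elim (b≢c (sym e))
triple-injective a≢b a≢c b≢c {suc (suc zero)} {suc (suc zero)} _ = refl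

other₂ : (i : Fin 2) → ∃ λ i′ → i′ ≢ i
other₂ zero = suc zero , λ ()
other₂ (suc zero) = zero , λ ()

other₃ : (j : Fin 3) → Σ (Fin 3) λ j₁ → Σ (Fin 3) λ j₂ → j₁ ≢ j × j₂ ≢ j × j₁ ≢ j₂
other₃ zero = suc zero , suc (suc zero) , (λ ()) , (λ ()) , (λ ())
other₃ (suc zero) = zero , suc (suc zero) , (λ ()) , (λ ()) , (λ ())
other₃ (suc (suc zero)) = zero , suc zero , (λ ()) , (λ ()) , (λ ())

no-K₂₃-from : ∀ {n} {E : BipGraph n} → ¬ CopyK 2 3 E → NoK₂₃ E
no-K₂₃-from {E = E} noCopy {u} {w} {y₁} {y₂} {y₃} u≢w y₁≢y₂ y₁≢y₃ y₂≢y₃ u₁ u₂ u₃ w₁ w₂ w₃ =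
  noCopy (pair u w , triple y₁ y₂ y₃ , pair-injective u≢w , triple-injective y₁≢y₂ y₁≢y₃ y₂≢y₃ , adj)
  where
    adj : ∀ i j → Adj E (pair u w i) (triple y₁ y₂ y₃ j)
    adj zero       zero             = u₁
    adj zero       (suc zero)       = u₂
    adj zero       (suc (suc zero)) = u₃
    adj (suc zero) zero             = w₁
    adj (suc zero) (suc zero)       = w₂
    adj (suc zero) (suc (suc zero)) = w₃

copyK-ᵀ : ∀ {n} {E : BipGraph n} → CopyK 2 3 (E ᵀ) → CopyK 3 2 E
copyK-ᵀ (f , g , f-inj , g-inj , adj) = g , f , g-inj , f-inj , λ i j → adj j i

copyKWith-ᵀ : ∀ {n} {E : BipGraph n} {u y} → CopyKWith 3 2 E u y → CopyKWith 2 3 (E ᵀ) y u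
copyKWith-ᵀ (f , g , f-inj , g-inj , adj , fu , gy) = g , f , g-inj , f-inj , (λ i j → adj j i) , gy , fu

AgreesOff : ∀ {n} → BipGraph n → BipGraph n → Fin n → Fin n → Set
AgreesOff {n} E′ E u y = ∀ {x z : Fin n} → E′ x z ≡ true → x ≢ u ⊎ z ≢ y → E x z ≡ true

addEdge-agrees : ∀ {n} (E : BipGraph n) {u y} → AgreesOff (addEdge E u y) E u y
addEdge-agrees E {u} {y} {x} {z} e off with E x z
... | true = refl
... | false with x ≟ u | z ≟ y | off
...   | yes x≡u | yes _   | inj₁ x≢u = ⊥-elim (x≢u x≡u)
...   | yes _   | yes z≡y | inj₂ z≢y = ⊥-elim (z≢y z≡y)
...   | yes _   | no _    | _ = e
...   | no _    | _       | _ = e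

AgreesOff-ᵀ : ∀ {n} {E′ E : BipGraph n} {u y} → AgreesOff E′ E u y → AgreesOff (E′ ᵀ) (E ᵀ) y u
AgreesOff-ᵀ agree e off = agree e (swap off)

completion-from-copy : ∀ {n} {E′ E : BipGraph n} {u y} → AgreesOff E′ E u y →
                       CopyKWith 2 3 E′ u y → Completion E u y
completion-from-copy {E = E} {u} {y} agree (f , g , f-inj , g-inj , adj , (i , fi≡u) , (j , gj≡y))
  with other₂ i | other₃ j
... | i′ , i′≢i | j₁ , j₂ , j₁≢j , j₂≢j , j₁≢j₂ =
  completion (f i′) w≢u (subst (λ z → E (f i′) z ≡ true) gj≡y (old i′ j (inj₁ w≢u)))
             (g j₁) (g j₂) (λ e → j₁≢j₂ (g-inj e))
             (u~ j₁ j₁≢j) (old i′ j₁ (inj₁ w≢u)) (u~ j₂ j₂≢j) (old i′ j₂ (inj₁ w≢u))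
  where
    old : ∀ p q → f p ≢ u ⊎ g q ≢ y → E (f p) (g q) ≡ true
    old p q off = agree (adj p q) off
    w≢u : f i′ ≢ u
    w≢u e = i′≢i (f-inj (trans e (sym fi≡u)))
    u~ : ∀ q → q ≢ j → E u (g q) ≡ true
    u~ q q≢j = subst (λ z → E z (g q) ≡ true) fi≡u
                 (old i q (inj₂ (λ e → q≢j (g-inj (trans e (sym gj≡y))))))

saturated⇒facts : ∀ {n} (E : BipGraph n) → K23Saturated E → SatFacts E
saturated⇒facts E (noCopy , sat) = record
  { no-K₂₃   = no-K₂₃-from (λ c → noCopy (inj₁ c))
  ; no-K₃₂   = no-K₂₃-from (λ c → noCopy (inj₂ (copyK-ᵀ {E = E} c)))
  ; complete = λ u y uy → completion-of (sat u y uy) }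
  where
    completion-of : ∀ {u y} → ContainsK23With (addEdge E u y) u y → Completion E u y ⊎ Completion (E ᵀ) y u
    completion-of {u} {y} (inj₁ c) = inj₁ (completion-from-copy (addEdge-agrees E) c)
    completion-of {u} {y} (inj₂ c) = inj₂ (completion-from-copy (AgreesOff-ᵀ (addEdge-agrees E)) (copyKWith-ᵀ {E = addEdge E u y} c))

min-degree-3-bound : ∀ {n} (E : BipGraph n) → (∀ s → 3 ≤ deg E s) → 3 * n ≤ edges E + 2
min-degree-3-bound {n} E deg≥3 = begin
  3 * n             ≡⟨ *-comm 3 n ⟩
  n * 3             ≡⟨ ∑-const n 3 ⟨
  sum {n} (λ _ → 3) ≤⟨ ∑-mono deg≥3 ⟩
  edges E           ≤⟨ m≤m+n (edges E) 2 ⟩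
  edges E + 2       ∎
  where open ≤-Reasoning

full-row-bound : ∀ {n} (E : BipGraph n) x → (∀ s → 2 ≤ deg E s) → (∀ y → E x y ≡ true) →
                 3 * n ≤ edges E + 2
full-row-bound {n} E x deg≥2 x-full = begin
  3 * n                      ≡⟨ +-comm n (2 * n) ⟩
  2 * n + n                  ≡⟨ cong₂ _+_ (trans (*-comm 2 n) (sym (∑-const n 2))) (sym deg-x) ⟩
  sum {n} (λ _ → 2) + deg E x ≤⟨ ∑-except-one (deg E) (λ _ → 2) x (λ s _ → deg≥2 s) ⟩
  edges E + 2                ∎
  where
    open ≤-Reasoning
    deg-x : deg E x ≡ n
    deg-x = trans (sum-cong-≗ (λ y → cong [_] (x-full y))) (trans (∑-const n 1) (*-identityʳ n))

module _ {n : ℕ} (E : BipGraph n) (S : SatFacts E) where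
  open SatFacts S

  -- Every row has a neighbour: a row missing the column y₀ meets a
  -- neighbour in the completion of uy₀.
  deg-positive : Fin n → ∀ u → 1 ≤ deg E u
  deg-positive y₀ u with E u y₀ in u~y₀
  ... | true = #-≥1 (E u) y₀ u~y₀
  ... | false with complete u y₀ u~y₀
  ...   | inj₁ (completion _ _ _ t₁ _ _ u~t₁ _ _ _) = #-≥1 (E u) t₁ u~t₁
  ...   | inj₂ (completion w _ u~w _ _ _ _ _ _ _) = #-≥1 (E u) w u~w

  -- Completing u with any other column y
  -- needs two rows adjacent to both y and v, so every column other than v
  -- has two neighbours in N(v); split the edges along N(v).
  pendant-bound : (∀ s → 1 ≤ deg E s) → ∀ u v → E u v ≡ true →
                  (∀ y → E u y ≡ true → y ≡ v) → 3 * n ≤ edges E + 2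
  pendant-bound deg≥1 u v u~v only-v = split-bound E Nv 0 ins out
    where
      Nv : Fin n → Bool
      Nv s = E s v
      spread : ∀ y → y ≢ v → 2 ≤ inside E Nv y
      spread y y≢v with E u y in u~y
      ... | true = ⊥-elim (y≢v (only-v y u~y))
      ... | false with complete u y u~y
      ...   | inj₁ (completion _ _ _ t₁ t₂ t₁≢t₂ u~t₁ _ u~t₂ _) =
              ⊥-elim (t₁≢t₂ (trans (only-v t₁ u~t₁) (sym (only-v t₂ u~t₂))))
      ...   | inj₂ (completion w _ u~w s₁ s₂ s₁≢s₂ s₁~y s₁~w s₂~y s₂~w) rewrite only-v w u~w =
              #-≥2 _ s₁ s₂ (∧-intro s₁~y s₁~w) (∧-intro s₂~y s₂~w) s₁≢s₂
      inside-v : inside E Nv v ≡ # Nv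
      inside-v = sum-cong-≗ (λ s → cong [_] (∧-idem (E s v)))
      ins : 2 * n + # Nv ≤ sum (inside E Nv) + 0 + 2
      ins = begin
        2 * n + # Nv                        ≡⟨ cong₂ _+_ (trans (*-comm 2 n) (sym (∑-const n 2))) (sym inside-v) ⟩
        sum {n} (λ _ → 2) + inside E Nv v   ≤⟨ ∑-except-one (inside E Nv) (λ _ → 2) v spread ⟩
        sum (inside E Nv) + 2               ≡⟨ cong (_+ 2) (+-identityʳ _) ⟨
        sum (inside E Nv) + 0 + 2           ∎
        where open ≤-Reasoning
      out : 0 + # (λ s → not (Nv s)) ≤ outside E Nv
      out = ≤-trans (≤-reflexive (sym (*-identityˡ _))) (outside-≥ E Nv 1 (λ s _ → deg≥1 s))

  -- A row u with exactly two neighbours a and b, all row and column degrees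
  -- at least two.  Split the edges along Nab = N(a) ∪ N(b).
  module TwoNeighbours (deg≥2 : ∀ s → 2 ≤ deg E s) (codeg≥2 : ∀ y → 2 ≤ deg (E ᵀ) y)
                       (u a b : Fin n) (a≢b : a ≢ b) (u~a : E u a ≡ true) (u~b : E u b ≡ true)
                       (only-ab : ∀ y → E u y ≡ true → y ≡ a ⊎ y ≡ b) where

    Na Nb Nab : Fin n → Bool
    Na s = E s a
    Nb s = E s b
    Nab s = Na s ∨ Nb s

    inAB : Fin n → ℕ
    inAB = inside E Nab

    Na⊆Nab : ∀ y s → E s y ∧ Na s ≡ true → E s y ∧ Nab s ≡ true
    Na⊆Nab y s h = ∧-intro (∧-elimˡ h) (∨-introˡ (∧-elimʳ {E s y} h))

    Nb⊆Nab : ∀ y s → E s y ∧ Nb s ≡ true → E s y ∧ Nab s ≡ true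
    Nb⊆Nab y s h = ∧-intro (∧-elimˡ h) (∨-introʳ {Na s} (∧-elimʳ {E s y} h))

    inAB-a : inAB a ≡ # Na
    inAB-a = sum-cong-≗ (λ s → cong [_] (∧-abs-∨ (E s a) (E s b)))

    inAB-b : inAB b ≡ # Nb
    inAB-b = sum-cong-≗ (λ s → cong [_] (trans (cong (E s b ∧_) (∨-comm (E s a) (E s b)))
                                               (∧-abs-∨ (E s b) (E s a))))

    CommonRow : Fin n → Set
    CommonRow y = Σ (Fin n) λ w → w ≢ u × E w a ≡ true × E w b ≡ true × E w y ≡ true

    -- Completing u with a column y ∉ {a, b}: either the partner row shares
    -- u's two neighbours a, b, or the partner column is a or b and y gets two
    -- neighbours in N(a) or in N(b).
    outer-column : ∀ y → y ≢ a → y ≢ b →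
                   CommonRow y ⊎ 2 ≤ # (λ s → E s y ∧ Na s) ⊎ 2 ≤ # (λ s → E s y ∧ Nb s)
    outer-column y y≢a y≢b with E u y in u~y
    ... | true with only-ab y u~y
    ...   | inj₁ y≡a = ⊥-elim (y≢a y≡a)
    ...   | inj₂ y≡b = ⊥-elim (y≢b y≡b)
    outer-column y y≢a y≢b | false with complete u y u~y
    ... | inj₁ (completion w w≢u w~y t₁ t₂ t₁≢t₂ u~t₁ w~t₁ u~t₂ w~t₂) =
          inj₁ (w , w≢u , proj₁ w~ab , proj₂ w~ab , w~y)
      where
        w~ab : E w a ≡ true × E w b ≡ true
        w~ab with only-ab t₁ u~t₁ | only-ab t₂ u~t₂
        ... | inj₁ refl | inj₁ refl = ⊥-elim (t₁≢t₂ refl)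
        ... | inj₁ refl | inj₂ refl = w~t₁ , w~t₂
        ... | inj₂ refl | inj₁ refl = w~t₂ , w~t₁
        ... | inj₂ refl | inj₂ refl = ⊥-elim (t₁≢t₂ refl)
    ... | inj₂ (completion w _ u~w s₁ s₂ s₁≢s₂ s₁~y s₁~w s₂~y s₂~w) with only-ab w u~w
    ...   | inj₁ refl = inj₂ (inj₁ (#-≥2 _ s₁ s₂ (∧-intro s₁~y s₁~w) (∧-intro s₂~y s₂~w) s₁≢s₂))
    ...   | inj₂ refl = inj₂ (inj₂ (#-≥2 _ s₁ s₂ (∧-intro s₁~y s₁~w) (∧-intro s₂~y s₂~w) s₁≢s₂))

    -- Case 1: u is the only row adjacent to both a and b.  Then
    -- |N(a)| + |N(b)| = |Nab| + 1, every column outside {a, b} has two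
    -- neighbours in Nab, and one of them has three.
    module UniqueCommon (no-other : ∀ x → x ≢ u → E x a ≡ true → E x b ≡ true → ⊥) where

      common-is-u : ∀ s → E s a ≡ true → E s b ≡ true → s ≡ u
      common-is-u s s~a s~b with s ≟ u
      ... | yes s≡u = s≡u
      ... | no s≢u = ⊥-elim (no-other s s≢u s~a s~b)

      common≐u : ∀ s → Na s ∧ Nb s ≡ s ≐ u
      common≐u s with s ≟ u
      ... | yes refl rewrite u~a | u~b = refl
      ... | no s≢u with E s a in s~a | E s b in s~b
      ...   | true  | true  = ⊥-elim (s≢u (common-is-u s s~a s~b))
      ...   | true  | false = refl
      ...   | false | _     = refl

      sizes : # Na + # Nb ≡ # Nab + 1
      sizes = trans (#-union Na Nb) (cong (# Nab +_) (trans (sum-cong-≗ (λ s → cong [_] (common≐u s))) (#-point u)))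

      outer≥2 : ∀ y → y ≢ a → y ≢ b → 2 ≤ inAB y
      outer≥2 y y≢a y≢b with outer-column y y≢a y≢b
      ... | inj₁ (w , w≢u , w~a , w~b , _) = ⊥-elim (no-other w w≢u w~a w~b)
      ... | inj₂ (inj₁ two) = ≤-trans two (#-mono (Na⊆Nab y))
      ... | inj₂ (inj₂ two) = ≤-trans two (#-mono (Nb⊆Nab y))

      three-via-a : ∀ y w → 2 ≤ # (λ s → E s y ∧ Na s) → E w y ≡ true → E w b ≡ true → E w a ≡ false → 3 ≤ inAB y
      three-via-a y w two w~y w~b w≁a = #-three _ _ w (Na⊆Nab y) two (∧-intro w~y (∨-introʳ {E w a} w~b)) (∧-falseʳ w≁a)

      three-via-b : ∀ y w → 2 ≤ # (λ s → E s y ∧ Nb s) → E w y ≡ true → E w a ≡ true → E w b ≡ false → 3 ≤ inAB y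
      three-via-b y w two w~y w~a w≁b = #-three _ _ w (Nb⊆Nab y) two (∧-intro w~y (∨-introˡ w~a)) (∧-falseʳ w≁b)

      second-a-row : ∃ λ s₀ → s₀ ≢ u × E s₀ a ≡ true × E s₀ b ≡ false
      second-a-row with #-witness (λ s → Na s ∧ not (s ≐ u)) (s≤s⁻¹ (≤-trans (codeg≥2 a) (≤-reflexive (#-remove Na u u~a))))
      ... | s₀ , h with E s₀ b in s₀~b
      ...   | true  = ⊥-elim (no-other s₀ (not≐⇒≢ (∧-elimʳ {Na s₀} h)) (∧-elimˡ h) s₀~b)
      ...   | false = s₀ , not≐⇒≢ (∧-elimʳ {Na s₀} h) , ∧-elimˡ h , s₀~b

      -- Completing s₀ with b produces a column outside {a, b} with three
      -- neighbours in Nab.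
      rich-column : ∃ λ y → y ≢ a × y ≢ b × 3 ≤ inAB y
      rich-column with second-a-row
      ... | s₀ , s₀≢u , s₀~a , s₀≁b with complete s₀ b s₀≁b
      ...   | inj₂ (completion w w≢b s₀~w s₁ s₂ s₁≢s₂ s₁~b s₁~w s₂~b s₂~w) =
              w , w≢a , w≢b , three-via-b w s₀ (#-≥2 _ s₁ s₂ (∧-intro s₁~w s₁~b) (∧-intro s₂~w s₂~b) s₁≢s₂) s₀~w s₀~a s₀≁b
        where
          w≢a : w ≢ a
          w≢a refl = s₁≢s₂ (trans (common-is-u s₁ s₁~w s₁~b) (sym (common-is-u s₂ s₂~w s₂~b)))
      ...   | inj₁ (completion w w≢s₀ w~b t₁ t₂ t₁≢t₂ s₀~t₁ w~t₁ s₀~t₂ w~t₂) = pick (t₁ ≟ a)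
        where
          common-with-u-is-a : ∀ t → E u t ≡ true → E s₀ t ≡ true → t ≡ a
          common-with-u-is-a t u~t s₀~t with only-ab t u~t
          ... | inj₁ t≡a = t≡a
          ... | inj₂ refl = ⊥-elim (true≢false s₀~t s₀≁b)
          w≢u : w ≢ u
          w≢u refl = t₁≢t₂ (trans (common-with-u-is-a t₁ w~t₁ s₀~t₁) (sym (common-with-u-is-a t₂ w~t₂ s₀~t₂)))
          w≁a : E w a ≡ false
          w≁a with E w a in w~a
          ... | true  = ⊥-elim (no-other w w≢u w~a w~b)
          ... | false = refl
          rich : ∀ t → t ≢ a → E s₀ t ≡ true → E w t ≡ true → ∃ λ y → y ≢ a × y ≢ b × 3 ≤ inAB y
          rich t t≢a s₀~t w~t with t ≟ b
          ... | yes refl = ⊥-elim (true≢false s₀~t s₀≁b)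
          ... | no t≢b with outer-column t t≢a t≢b
          ...   | inj₁ (w′ , w′≢u , w′~a , w′~b , _) = ⊥-elim (no-other w′ w′≢u w′~a w′~b)
          ...   | inj₂ (inj₁ two) = t , t≢a , t≢b , three-via-a t w two w~t w~b w≁a
          ...   | inj₂ (inj₂ two) = t , t≢a , t≢b , three-via-b t s₀ two s₀~t s₀~a s₀≁b
          pick : Dec (t₁ ≡ a) → ∃ λ y → y ≢ a × y ≢ b × 3 ≤ inAB y
          pick (yes t₁≡a) = rich t₂ (λ t₂≡a → t₁≢t₂ (trans t₁≡a (sym t₂≡a))) s₀~t₂ w~t₂
          pick (no t₁≢a) = rich t₁ t₁≢a s₀~t₁ w~t₁

      -- Two per outer column, one more at the rich column, |N(a)| + |N(b)| at
      -- a and b; the rows outside Nab have degree at least two.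
      bound : 3 * n ≤ edges E + 2
      bound with rich-column
      ... | y₃ , y₃≢a , y₃≢b , y₃-rich = split-bound E Nab 0 ins out
        where
          F : Fin n → ℕ
          F y = 2 + [ y ≐ y₃ ]
          F≤ : ∀ y → y ≢ a → y ≢ b → 2 + [ y ≐ y₃ ] ≤ inAB y
          F≤ y y≢a y≢b with y ≟ y₃
          ... | yes refl = y₃-rich
          ... | no _ = outer≥2 y y≢a y≢b
          F-off : ∀ {y} → y ≢ y₃ → F y ≡ 2
          F-off y≢y₃ = cong (λ b → 2 + [ b ]) (≐-≢ y≢y₃)
          sum-F : sum F ≡ 2 * n + 1
          sum-F = trans (∑-distrib-+ (λ _ → 2) (λ y → [ y ≐ y₃ ]))
                        (cong₂ _+_ (trans (∑-const n 2) (*-comm n 2)) (#-point y₃))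
          regroup : ∀ m c → m + c + 2 ≡ m + 1 + (c + 1)
          regroup = solve-∀
          ins : 2 * n + # Nab ≤ sum inAB + 0 + 2
          ins = +-cancelʳ-≤ 2 _ _ (begin
            2 * n + # Nab + 2              ≡⟨ regroup (2 * n) (# Nab) ⟩
            2 * n + 1 + (# Nab + 1)        ≡⟨ cong₂ _+_ sum-F (trans (cong₂ _+_ inAB-a inAB-b) sizes) ⟨
            sum F + (inAB a + inAB b)      ≡⟨ +-assoc (sum F) (inAB a) (inAB b) ⟨
            sum F + inAB a + inAB b        ≤⟨ ∑-except-two inAB F a b a≢b F≤ ⟩
            sum inAB + F a + F b           ≡⟨ cong₂ (λ p q → sum inAB + p + q) (F-off (y₃≢a ∘ sym)) (F-off (y₃≢b ∘ sym)) ⟩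
            sum inAB + 2 + 2               ≡⟨ cong (λ m → m + 2 + 2) (+-identityʳ (sum inAB)) ⟨
            sum inAB + 0 + 2 + 2           ∎)
            where open ≤-Reasoning
          out : 0 + # (λ s → not (Nab s)) ≤ outside E Nab
          out = ≤-trans (m≤m+n _ _) (outside-≥ E Nab 2 (λ s _ → deg≥2 s))

    -- Case 2: a second row x ≠ u is adjacent to both a and b.  By the absence
    -- of a K_{2,3} with three rows, u and x are the only such rows, so
    -- |N(a)| + |N(b)| = |Nab| + 2.
    module SecondCommon (x : Fin n) (x≢u : x ≢ u) (x~a : E x a ≡ true) (x~b : E x b ≡ true) where

      -- Three common neighbours of a and b would form a K_{2,3} with three rows.
      common-rows : ∀ s → E s a ≡ true → E s b ≡ true → s ≡ u ⊎ s ≡ x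
      common-rows s s~a s~b with s ≟ u | s ≟ x
      ... | yes s≡u | _       = inj₁ s≡u
      ... | no _    | yes s≡x = inj₂ s≡x
      ... | no s≢u  | no s≢x  =
            ⊥-elim (no-K₃₂ a≢b (x≢u ∘ sym) (s≢u ∘ sym) (s≢x ∘ sym) u~a x~a s~a u~b x~b s~b)

      common≐ : ∀ s → [ Na s ∧ Nb s ] ≡ [ s ≐ u ] + [ s ≐ x ]
      common≐ s with s ≟ u | s ≟ x
      ... | yes refl | yes refl = ⊥-elim (x≢u refl)
      ... | yes refl | no _ rewrite u~a | u~b = refl
      ... | no _ | yes refl rewrite x~a | x~b = refl
      ... | no s≢u | no s≢x with E s a in s~a | E s b in s~b
      ...   | true  | true  = ⊥-elim (neither (common-rows s s~a s~b))
        where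
          neither : s ≡ u ⊎ s ≡ x → ⊥
          neither (inj₁ s≡u) = s≢u s≡u
          neither (inj₂ s≡x) = s≢x s≡x
      ...   | true  | false = refl
      ...   | false | _     = refl

      sizes : # Na + # Nb ≡ # Nab + 2
      sizes = trans (#-union Na Nb) (cong (# Nab +_) (begin
        # (λ s → Na s ∧ Nb s)                 ≡⟨ sum-cong-≗ common≐ ⟩
        sum (λ s → [ s ≐ u ] + [ s ≐ x ])     ≡⟨ ∑-distrib-+ (λ s → [ s ≐ u ]) (λ s → [ s ≐ x ]) ⟩
        # (λ s → s ≐ u) + # (λ s → s ≐ x)     ≡⟨ cong₂ _+_ (#-point u) (#-point x) ⟩
        2                                     ∎))
        where open ≡-Reasoning

      -- Call a column thin if it lies
      -- outside {a, b} and has fewer than two neighbours in Nab; with k thin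
      -- columns, the inside count falls short by at most k, and the rows
      -- outside Nab make up for it.
      module ThinColumns (y₀ : Fin n) (x≁y₀ : E x y₀ ≡ false) where

        thin : Fin n → Bool
        thin y = not (y ≐ a) ∧ (not (y ≐ b) ∧ does (inAB y <? 2))

        thin-spec : ∀ {y} → thin y ≡ true → y ≢ a × y ≢ b × inAB y < 2
        thin-spec {y} h =
          not≐⇒≢ (∧-elimˡ h) , not≐⇒≢ (∧-elimˡ thin′) , does-sound (inAB y <? 2) (∧-elimʳ {not (y ≐ b)} thin′)
          where thin′ = ∧-elimʳ {not (y ≐ a)} h

        thick : ∀ y → y ≢ a → y ≢ b → thin y ≡ false → 2 ≤ inAB y
        thick y y≢a y≢b h rewrite ≐-≢ y≢a | ≐-≢ y≢b = ≮⇒≥ (does-refute (inAB y <? 2) h)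

        thin-a : thin a ≡ false
        thin-a rewrite ≐-refl a = refl

        thin-b : thin b ≡ false
        thin-b rewrite ≐-refl b = ∧-zeroʳ (not (b ≐ a))

        thin-not-two : ∀ {y} → thin y ≡ true → 2 ≤ inAB y → ⊥
        thin-not-two h two = <⇒≱ (proj₂ (proj₂ (thin-spec h))) two

        thin⇒x~ : ∀ y → thin y ≡ true → E x y ≡ true
        thin⇒x~ y h with thin-spec h
        ... | y≢a , y≢b , _ with outer-column y y≢a y≢b
        ...   | inj₂ (inj₁ two) = ⊥-elim (thin-not-two h (≤-trans two (#-mono (Na⊆Nab y))))
        ...   | inj₂ (inj₂ two) = ⊥-elim (thin-not-two h (≤-trans two (#-mono (Nb⊆Nab y))))
        ...   | inj₁ (w , w≢u , w~a , w~b , w~y) with common-rows w w~a w~b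
        ...     | inj₁ w≡u = ⊥-elim (w≢u w≡u)
        ...     | inj₂ refl = w~y

        thin⇒only-x : ∀ y → thin y ≡ true → ∀ s → E s y ≡ true → Nab s ≡ true → s ≡ x
        thin⇒only-x y h s s~y s∈Nab with s ≟ x
        ... | yes s≡x = s≡x
        ... | no s≢x = ⊥-elim (thin-not-two h
                         (#-≥2 _ s x (∧-intro s~y s∈Nab) (∧-intro (thin⇒x~ y h) (∨-introˡ x~a)) s≢x))

        y₀-thick : thin y₀ ≡ false
        y₀-thick with thin y₀ in h
        ... | true  = ⊥-elim (true≢false (thin⇒x~ y₀ h) x≁y₀)
        ... | false = refl

        k : ℕ
        k = # thin

        -- Each thin column still has x in Nab, so adding one for it restores
        -- the bound of two per column outside {a, b}.
        ins : 2 * n + # Nab ≤ sum inAB + k + 2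
        ins = +-cancelʳ-≤ 2 _ _ (begin
          2 * n + # Nab + 2              ≡⟨ +-assoc (2 * n) (# Nab) 2 ⟩
          2 * n + (# Nab + 2)            ≡⟨ cong₂ _+_ (trans (*-comm 2 n) (sym (∑-const n 2)))
                                                       (sym (trans (cong₂ _+_ inAB-a inAB-b) sizes)) ⟩
          two + (inAB a + inAB b)        ≡⟨ +-assoc two (inAB a) (inAB b) ⟨
          two + inAB a + inAB b          ≡⟨ cong₂ (λ p q → two + p + q) (padded-off thin-a) (padded-off thin-b) ⟨
          two + padded a + padded b      ≤⟨ ∑-except-two padded (λ _ → 2) a b a≢b padded≥2 ⟩
          sum padded + 2 + 2             ≡⟨ cong (λ m → m + 2 + 2) (∑-distrib-+ inAB (λ y → [ thin y ])) ⟩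
          sum inAB + k + 2 + 2           ∎)
          where
            open ≤-Reasoning
            two : ℕ
            two = sum {n} (λ _ → 2)
            padded : Fin n → ℕ
            padded y = inAB y + [ thin y ]
            padded-off : ∀ {y} → thin y ≡ false → padded y ≡ inAB y
            padded-off {y} h = trans (cong (λ b → inAB y + [ b ]) h) (+-identityʳ (inAB y))
            padded≥2 : ∀ y → y ≢ a → y ≢ b → 2 ≤ inAB y + [ thin y ]
            padded≥2 y y≢a y≢b with thin y in h
            ... | true  = +-monoˡ-≤ 1 (#-≥1 _ x (∧-intro (thin⇒x~ y h) (∨-introˡ x~a)))
            ... | false = ≤-trans (thick y y≢a y≢b h) (m≤m+n _ 0)

        Z : Fin n → Bool
        Z s = not (Nab s)

        isolated : Fin n → Bool
        isolated s = does (# (λ y → E s y ∧ not (thin y)) ≟ℕ 0)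

        isolated⇒thin : ∀ {s y} → isolated s ≡ true → E s y ≡ true → thin y ≡ true
        isolated⇒thin {s} {y} iso s~y = not-false (trans (sym (cong (_∧ not (thin y)) s~y))
          (#-empty (λ y → E s y ∧ not (thin y)) (does-sound (_ ≟ℕ 0) iso) y))

        thick-neighbour : ∀ {s y} → E s y ≡ true → thin y ≡ false → isolated s ≡ false
        thick-neighbour {s} {y} s~y y-thick =
          dec-false (_ ≟ℕ 0) (λ none → 1+n≰n (≤-trans (#-≥1 _ y (∧-intro s~y (cong not y-thick))) (≤-reflexive none)))

        not-isolated : ∀ {s} → isolated s ≡ false → ∃ λ y → E s y ≡ true × thin y ≡ false
        not-isolated {s} h with #-witness (λ y → E s y ∧ not (thin y)) (n≢0⇒n>0 (does-refute (_ ≟ℕ 0) h))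
        ... | y , p = y , ∧-elimˡ p , not-true (∧-elimʳ {E s y} p)

        Zy lonely good : Fin n → Fin n → Bool
        Zy y s = E s y ∧ Z s
        lonely y s = Zy y s ∧ isolated s
        good y s = Zy y s ∧ not (isolated s)

        popular : Fin n → Bool
        popular y = thin y ∧ does (2 ≤? # (good y))

        -- Completing
        -- s with y₀: a partner row would form a K_{2,3} with x and s on two thin
        -- columns; so the partner is a (thin) column w of s, and the two rows
        -- adjacent to y₀ and w are non-isolated and lie outside Nab.
        popular-neighbour : ∀ s → Z s ≡ true → isolated s ≡ true → ∃ λ y → E s y ≡ true × popular y ≡ true
        popular-neighbour s s∈Z iso with E s y₀ in s~y₀
        ... | true = ⊥-elim (true≢false (isolated⇒thin iso s~y₀) y₀-thick)
        ... | false with complete s y₀ s~y₀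
        ...   | inj₁ (completion w w≢s w~y₀ t₁ t₂ t₁≢t₂ s~t₁ w~t₁ s~t₂ w~t₂) =
                ⊥-elim (no-K₃₂ t₁≢t₂ x≢s x≢w (w≢s ∘ sym)
                          (thin⇒x~ t₁ (isolated⇒thin iso s~t₁)) s~t₁ w~t₁
                          (thin⇒x~ t₂ (isolated⇒thin iso s~t₂)) s~t₂ w~t₂)
          where
            x≢s : x ≢ s
            x≢s refl = true≢false (∨-introˡ x~a) (not-true s∈Z)
            x≢w : x ≢ w
            x≢w refl = true≢false w~y₀ x≁y₀
        ...   | inj₂ (completion w _ s~w s₁ s₂ s₁≢s₂ s₁~y₀ s₁~w s₂~y₀ s₂~w) =
                w , s~w , ∧-intro w-thin (dec-true (2 ≤? _) (#-≥2 _ s₁ s₂ (good-row s₁~y₀ s₁~w) (good-row s₂~y₀ s₂~w) s₁≢s₂))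
          where
            w-thin : thin w ≡ true
            w-thin = isolated⇒thin iso s~w
            good-row : ∀ {t} → E t y₀ ≡ true → E t w ≡ true → good w t ≡ true
            good-row {t} t~y₀ t~w = ∧-intro (∧-intro t~w t∉Nab) (cong not (thick-neighbour t~y₀ y₀-thick))
              where
                t∉Nab : not (Nab t) ≡ true
                t∉Nab with Nab t in t∈Nab
                ... | true  = ⊥-elim (true≢false (subst (λ r → E r y₀ ≡ true) (thin⇒only-x w w-thin t t~w t∈Nab) t~y₀) x≁y₀)
                ... | false = refl

        -- A thin column y has at least one neighbour outside Nab (its degree
        -- is at least two, at most one neighbour lies in Nab), and if it is
        -- popular, at least one more than it has isolated ones.
        per-column : ∀ y → [ thin y ] + # (λ s → lonely y s ∧ popular y) ≤ # (λ s → Zy y s ∧ thin y)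
        per-column y = by-thinness (thin y) refl
          where
            by-thinness : ∀ t → thin y ≡ t → [ t ] + # (λ s → lonely y s ∧ popular y) ≤ # (λ s → Zy y s ∧ t)
            by-thinness false y-thick =
              ≤-trans (≤-reflexive (#-none (λ s → lonely y s ∧ popular y) (λ s → ∧-falseʳ {lonely y s} not-popular))) z≤n
              where
                not-popular : popular y ≡ false
                not-popular = cong (_∧ does (2 ≤? # (good y))) y-thick
            by-thinness true y-thin = begin
              1 + # (λ s → lonely y s ∧ popular y)  ≤⟨ with-popular (popular y) refl ⟩
              # (Zy y)                              ≡⟨ sum-cong-≗ (λ s → cong [_] (∧-identityʳ (Zy y s))) ⟨
              # (λ s → Zy y s ∧ true)               ∎
              where
                open ≤-Reasoning
                Zy-split : # (Zy y) ≡ # (lonely y) + # (good y)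
                Zy-split = #-split (Zy y) isolated
                Zy-nonempty : 1 ≤ # (Zy y)
                Zy-nonempty = s≤s⁻¹ (begin
                  2                      ≤⟨ codeg≥2 y ⟩
                  deg (E ᵀ) y            ≡⟨ #-split (λ s → E s y) Nab ⟩
                  inAB y + # (Zy y)      ≤⟨ +-monoˡ-≤ (# (Zy y)) (s≤s⁻¹ (proj₂ (proj₂ (thin-spec y-thin)))) ⟩
                  1 + # (Zy y)           ∎)
                with-popular : ∀ p → popular y ≡ p → 1 + # (λ s → lonely y s ∧ p) ≤ # (Zy y)
                with-popular false _ = ≤-trans (≤-reflexive (cong suc (#-none _ (λ s → ∧-zeroʳ (lonely y s))))) Zy-nonempty
                with-popular true p = begin
                  1 + # (λ s → lonely y s ∧ true)   ≡⟨ cong suc (sum-cong-≗ (λ s → cong [_] (∧-identityʳ (lonely y s)))) ⟩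
                  1 + # (lonely y)                  ≤⟨ m≤n+m _ 1 ⟩
                  1 + 1 + # (lonely y)              ≡⟨ +-comm 2 (# (lonely y)) ⟩
                  # (lonely y) + 2                  ≤⟨ +-monoʳ-≤ (# (lonely y)) (does-sound (2 ≤? _) (∧-elimʳ {thin y} p)) ⟩
                  # (lonely y) + # (good y)         ≡⟨ Zy-split ⟨
                  # (Zy y)                          ∎

        lonely-count : # (λ s → Z s ∧ isolated s) ≤ sum (λ y → # (λ s → lonely y s ∧ popular y))
        lonely-count = begin
          # (λ s → Z s ∧ isolated s)                          ≤⟨ ∑-mono (λ s → []-≤ (per-row s)) ⟩
          sum (λ s → # (λ y → lonely y s ∧ popular y))        ≡⟨ ∑-comm (λ s y → [ lonely y s ∧ popular y ]) ⟩
          sum (λ y → # (λ s → lonely y s ∧ popular y))        ∎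
          where
            open ≤-Reasoning
            per-row : ∀ s → Z s ∧ isolated s ≡ true → 1 ≤ # (λ y → lonely y s ∧ popular y)
            per-row s h with popular-neighbour s (∧-elimˡ h) (∧-elimʳ {Z s} h)
            ... | y , s~y , y-popular =
                  #-≥1 _ y (∧-intro (∧-intro (∧-intro s~y (∧-elimˡ h)) (∧-elimʳ {Z s} h)) y-popular)

        thin-part : k + # (λ s → Z s ∧ isolated s) ≤ sum (λ s → # (λ y → Zy y s ∧ thin y))
        thin-part = begin
          k + # (λ s → Z s ∧ isolated s)                                  ≤⟨ +-monoʳ-≤ k lonely-count ⟩
          k + sum (λ y → # (λ s → lonely y s ∧ popular y))                ≡⟨ ∑-distrib-+ (λ y → [ thin y ]) _ ⟨
          sum (λ y → [ thin y ] + # (λ s → lonely y s ∧ popular y))        ≤⟨ ∑-mono per-column ⟩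
          sum (λ y → # (λ s → Zy y s ∧ thin y))                           ≡⟨ ∑-comm (λ y s → [ Zy y s ∧ thin y ]) ⟩
          sum (λ s → # (λ y → Zy y s ∧ thin y))                           ∎
          where open ≤-Reasoning

        rest-part : # (λ s → Z s ∧ not (isolated s)) ≤ sum (λ s → # (λ y → Zy y s ∧ not (thin y)))
        rest-part = ∑-mono (λ s → []-≤ (per-row s))
          where
            per-row : ∀ s → Z s ∧ not (isolated s) ≡ true → 1 ≤ # (λ y → Zy y s ∧ not (thin y))
            per-row s h with not-isolated (not-true (∧-elimʳ {Z s} h))
            ... | y , s~y , y-thick = #-≥1 _ y (∧-intro (∧-intro s~y (∧-elimˡ h)) (cong not y-thick))

        out : k + # Z ≤ outside E Nab
        out = begin
          k + # Z                                                   ≡⟨ cong (k +_) (#-split Z isolated) ⟩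
          k + (# (λ s → Z s ∧ isolated s) + # (λ s → Z s ∧ not (isolated s)))
                                                                    ≡⟨ +-assoc k _ _ ⟨
          k + # (λ s → Z s ∧ isolated s) + # (λ s → Z s ∧ not (isolated s))
                                                                    ≤⟨ +-mono-≤ thin-part rest-part ⟩
          sum (λ s → # (λ y → Zy y s ∧ thin y)) + sum (λ s → # (λ y → Zy y s ∧ not (thin y)))
                                                                    ≡⟨ ∑-distrib-+ (λ s → # (λ y → Zy y s ∧ thin y)) (λ s → # (λ y → Zy y s ∧ not (thin y))) ⟨
          sum (λ s → # (λ y → Zy y s ∧ thin y) + # (λ y → Zy y s ∧ not (thin y)))
                                                                    ≡⟨ sum-cong-≗ (λ s → #-split (λ y → Zy y s) thin) ⟨
          outside E Nab                                             ∎
          where open ≤-Reasoning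

        bound : 3 * n ≤ edges E + 2
        bound = split-bound E Nab k ins out

      bound : 3 * n ≤ edges E + 2
      bound with all? (λ y → E x y ≟ᵇ true)
      ... | yes x-full = full-row-bound E x deg≥2 x-full
      ... | no x-not-full with ¬∀⟶∃¬ n _ (λ y → E x y ≟ᵇ true) x-not-full
      ...   | y₀ , x≁y₀ = ThinColumns.bound y₀ (¬-not x≁y₀)

    bound : 3 * n ≤ edges E + 2
    bound with any? (λ x → ¬? (x ≟ u) ×-dec (E x a ≟ᵇ true) ×-dec (E x b ≟ᵇ true))
    ... | yes (x , x≢u , x~a , x~b) = SecondCommon.bound x x≢u x~a x~b
    ... | no none = UniqueCommon.bound (λ x x≢u x~a x~b → none (x , x≢u , x~a , x~b))

below-or-all-above : ∀ {n} (f : Fin n → ℕ) c → (∃ λ i → f i < c) ⊎ (∀ i → c ≤ f i)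
below-or-all-above {n} f c with all? (λ i → c ≤? f i)
... | yes all-above = inj₂ all-above
... | no not-all with ¬∀⟶∃¬ n _ (λ i → c ≤? f i) not-all
...   | i , fi≱c = inj₁ (i , ≰⇒> fi≱c)

saturated-bound : ∀ {n} (E : BipGraph n) → SatFacts E → Fin n → 3 * n ≤ edges E + 2
saturated-bound {n} E S y₀ with below-or-all-above (deg (E ᵀ)) 2
... | inj₁ (y , codeg-y<2) with #-unique ((E ᵀ) y) (deg-positive (E ᵀ) (SatFacts-ᵀ S) y₀ y) (s≤s⁻¹ codeg-y<2)
...   | v , y~v , only-v = begin
          3 * n               ≤⟨ pendant-bound (E ᵀ) (SatFacts-ᵀ S) (deg-positive (E ᵀ) (SatFacts-ᵀ S) y₀) y v y~v only-v ⟩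
          edges (E ᵀ) + 2     ≡⟨ cong (_+ 2) (edges-ᵀ E) ⟩
          edges E + 2         ∎
  where open ≤-Reasoning
saturated-bound {n} E S y₀ | inj₂ codeg≥2 with below-or-all-above (deg E) 2
... | inj₁ (u , deg-u<2) with #-unique (E u) (deg-positive E S y₀ u) (s≤s⁻¹ deg-u<2)
...   | v , u~v , only-v = pendant-bound E S (deg-positive E S y₀) u v u~v only-v
saturated-bound {n} E S y₀ | inj₂ codeg≥2 | inj₂ deg≥2 with below-or-all-above (deg E) 3
... | inj₂ deg≥3 = min-degree-3-bound E deg≥3
... | inj₁ (u , deg-u<3) with #-pair (E u) (deg≥2 u) (s≤s⁻¹ deg-u<3)
...   | a , b , a≢b , u~a , u~b , only-ab =
          TwoNeighbours.bound E S deg≥2 codeg≥2 u a b a≢b u~a u~b only-ab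

-- The theorem: n ≥ 4 ensures a column exists, and the list-based edge count
-- is edges E.
theorem4p1 : (n : ℕ) → 4 ≤ n → (E : BipGraph n) → K23Saturated E →
    3 * n ∸ 2 ≤ edgeCount E
theorem4p1 zero () E saturated
theorem4p1 (suc m) _ E saturated = m≤n+o⇒m∸n≤o (3 * suc m) 2 (begin
  3 * suc m           ≤⟨ saturated-bound E (saturated⇒facts E saturated) zero ⟩
  edges E + 2         ≡⟨ +-comm (edges E) 2 ⟩
  2 + edges E         ≡⟨ cong (2 +_) (edgeCount≡edges E) ⟨
  2 + edgeCount E     ∎)
  where open ≤-Reasoning
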